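{- For every positive integer $n$, writing the $n$-th $P$-sequence as $P_n=\langle a_0,\dots,a_k\rangle$ and setting $F_{n,s}(x)=\sum_{i=0}^k a_i(i+x)^s$, the polynomial function $F_{n,s}$ is identically zero for every $s\in\{0,1,\dots,n-1\}$.
   Context: Convention: $0^0=1$. $P$-sequences are finite sequences of integers defined recursively: $\langle 1,-1\rangle$ is a $P$-sequence; if $\langle a_0,\dots,a_k\rangle$ is a $P$-sequence with $a_0=-a_k$, then $\langle a_0,\dots,a_k,a_k,\dots,a_0\rangle$ (the sequence followed by its reversal) is a $P$-sequence; if $\langle a_0,\dots,a_k\rangle$ is a $P$-sequence with $a_0=a_k$, then $\langle a_0,\dots,a_{k-1},0,-a_{k-1},\dots,-a_0\rangle$ is a $P$-sequence; and every $P$-sequence arises by finitely many applications of these clauses. Ordering $P$-sequences by increasing length, $P_n$ denotes the $n$-th one; e.g. $P_1=\langle 1,-1\rangle$, $P_2=\langle 1,-1,-1,1\rangle$, $P_3=\langle 1,-1,-1,0,1,1,-1\rangle$. For $P_n=\langle a_0,\dots,a_k\rangle$ and integer $s\ge 0$, $F_{n,s}(x)=\sum_{i=0}^k a_i(i+x)^s$. -}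

module Defs where

open import Data.Nat using (ℕ; zero; suc; _∸_)
open import Data.Integer using (ℤ; +_; -_; _+_; _*_; _^_; _≟_)
open import Data.List using (List; []; _∷_; _++_; reverse; map; head; last; length)
open import Data.Maybe using (Maybe; just; nothing)
open import Relation.Nullary using (yes; no)
open import Function using (_∘_)

init : List ℤ → List ℤ
init []           = []
init (x ∷ [])     = []
init (x ∷ y ∷ xs) = x ∷ init (y ∷ xs)

mirror : List ℤ → List ℤ
mirror xs = xs ++ reverse xs

antimirror : List ℤ → List ℤ
antimirror xs = init xs ++ (+ 0 ∷ map -_ (reverse (init xs)))

-- Since a_0 = 1 ≠ 0 for
-- every P-sequence, exactly one clause applies, so the P-sequences form a
-- single chain of strictly increasing length; the fall-through cases
-- never occur.
step : List ℤ → List ℤ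
step xs with head xs | last xs
... | just a₀ | just aₖ with a₀ ≟ - aₖ
...   | yes _ = mirror xs
...   | no  _ with a₀ ≟ aₖ
...     | yes _ = antimirror xs
...     | no  _ = xs
step xs | _ | _ = xs

iter : ℕ → List ℤ → List ℤ
iter zero    xs = xs
iter (suc m) xs = step (iter m xs)

-- P n = P_n, the n-th P-sequence by increasing length (n ≥ 1);
-- P 1 = ⟨1,-1⟩.  (P 0 is a junk value, never used.)
P : ℕ → List ℤ
P n = iter (n ∸ 1) (+ 1 ∷ - (+ 1) ∷ [])

Fsum : ℕ → List ℤ → ℕ → ℤ → ℤ
Fsum j []       s x = + 0
Fsum j (a ∷ as) s x = a * ((+ j + x) ^ s) + Fsum (suc j) as s x

-- F_{n,s}(x) = Σ_{i=0}^k a_i (i+x)^s for P_n = ⟨a_0,…,a_k⟩ (0^0 = 1)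
F : ℕ → ℕ → ℤ → ℤ
F n s x = Fsum 0 (P n) s x

-- Read a list ⟨a₀,…,a_k⟩ as the operator L f x = Σ a_i f(x + i).  Both
-- construction steps turn L into f x ↦ L f x − L f (x + m), which is −L composed
-- with the finite difference Δ_m: for mirror this needs L antisymmetric (m = k + 1),
-- for antimirror symmetric (m = k), and the P_n alternate between the two.  Since
-- Δ_m lowers the degree of a polynomial function by one, induction shows that P_n
-- annihilates every polynomial function of degree < n, in particular y ↦ y^s.
module Submission where

open import Defs
open import Data.Nat using (ℕ; zero; suc; _<_; _≤_; z≤n; s≤s)
open import Data.Integer as ℤ using (ℤ; +_; -_; _+_; _-_; _*_; _^_; _≟_)
open import Data.Integer.Properties using (*-zeroʳ; +-identityˡ; +-identityʳ; +-assoc; +-commutativeSemigroup; neg-involutive)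
open import Data.Integer.Tactic.RingSolver using (solve-∀)
open import Algebra.Properties.CommutativeSemigroup +-commutativeSemigroup using (xy∙z≈xz∙y)
open import Data.List using (List; []; _∷_; _++_; _∷ʳ_; reverse; map; head; last; length)
open import Data.List.Properties using (reverse-++; reverse-involutive; reverse-map; unfold-reverse; ++-assoc; map-++; map-∘; map-cong; map-id)
open import Data.List.Reverse using (reverseView; []; _∶_∶ʳ_)
open import Data.Maybe using (just)
open import Data.Sum using (_⊎_; inj₁; inj₂)
open import Relation.Nullary using (yes; no; ¬_; contradiction)
open import Relation.Binary.PropositionalEquality using (_≡_; refl; sym; trans; cong; cong₂; subst; module ≡-Reasoning)
open ≡-Reasoning

Δ : ℤ → (ℤ → ℤ) → ℤ → ℤ
Δ m f y = f (y + m) - f y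

data DegreeBelow : ℕ → (ℤ → ℤ) → Set where
  vanishes    : ∀ {f} → (∀ y → f y ≡ + 0) → DegreeBelow zero f
  differences : ∀ {n f} → (∀ m → DegreeBelow n (Δ m f)) → DegreeBelow (suc n) f

degreeBelow-cong : ∀ {n f g} → (∀ y → f y ≡ g y) → DegreeBelow n f → DegreeBelow n g
degreeBelow-cong f≗g (vanishes z)    = vanishes λ y → trans (sym (f≗g y)) (z y)
degreeBelow-cong f≗g (differences d) =
  differences λ m → degreeBelow-cong (λ y → cong₂ _-_ (f≗g (y + m)) (f≗g y)) (d m)

degreeBelow-+ : ∀ {n f g} → DegreeBelow n f → DegreeBelow n g → DegreeBelow n (λ y → f y + g y)
degreeBelow-+ (vanishes zf) (vanishes zg) = vanishes λ y → cong₂ _+_ (zf y) (zg y)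
degreeBelow-+ {f = f} {g} (differences df) (differences dg) =
  differences λ m → degreeBelow-cong (λ y → Δ-+ (f (y + m)) (f y) (g (y + m)) (g y))
                                     (degreeBelow-+ (df m) (dg m))
  where
  Δ-+ : ∀ a b c d → (a - b) + (c - d) ≡ (a + c) - (b + d)
  Δ-+ = solve-∀

degreeBelow-*ˡ : ∀ {n f} c → DegreeBelow n f → DegreeBelow n (λ y → c * f y)
degreeBelow-*ˡ c (vanishes z) = vanishes λ y → trans (cong (c *_) (z y)) (*-zeroʳ c)
degreeBelow-*ˡ {f = f} c (differences d) =
  differences λ m → degreeBelow-cong (λ y → Δ-*ˡ c (f (y + m)) (f y)) (degreeBelow-*ˡ c (d m))
  where
  Δ-*ˡ : ∀ c a b → c * (a - b) ≡ c * a - c * b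
  Δ-*ˡ = solve-∀

degreeBelow-shift : ∀ {n f} c → DegreeBelow n f → DegreeBelow n (λ y → f (y + c))
degreeBelow-shift c (vanishes z) = vanishes λ y → z (y + c)
degreeBelow-shift {f = f} c (differences d) =
  differences λ m → degreeBelow-cong (λ y → cong (λ z → f z - f (y + c)) (xy∙z≈xz∙y y c m))
                                     (degreeBelow-shift c (d m))

degreeBelow-mono : ∀ {m n f} → m ≤ n → DegreeBelow m f → DegreeBelow n f
degreeBelow-mono {n = zero}  z≤n     d               = d
degreeBelow-mono {n = suc n} z≤n     (vanishes z)    =
  differences λ c → degreeBelow-mono z≤n (vanishes λ y → cong₂ _-_ (z (y + c)) (z y))
degreeBelow-mono             (s≤s p) (differences d) = differences λ c → degreeBelow-mono p (d c)

degreeBelow-*id : ∀ {n f} → DegreeBelow n f → DegreeBelow (suc n) (λ y → y * f y)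
degreeBelow-*id (vanishes z) = differences λ m → vanishes λ y →
  trans (cong₂ (λ u v → (y + m) * u - y * v) (z (y + m)) (z y)) (vanish y m)
  where
  vanish : ∀ y m → (y + m) * + 0 - y * + 0 ≡ + 0
  vanish = solve-∀
degreeBelow-*id {f = f} df@(differences d) = differences λ m →
  degreeBelow-cong (λ y → sym (product-rule y m (f (y + m)) (f y)))
    (degreeBelow-+ (degreeBelow-*id (d m)) (degreeBelow-*ˡ m (degreeBelow-shift m df)))
  where
  product-rule : ∀ y m a b → (y + m) * a - y * b ≡ y * (a - b) + m * a
  product-rule = solve-∀

degreeBelow-^ : ∀ s → DegreeBelow (suc s) (_^ s)
degreeBelow-^ zero    = differences λ _ → vanishes λ _ → refl
degreeBelow-^ (suc s) = degreeBelow-*id (degreeBelow-^ s)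

shiftSum : List ℤ → (ℤ → ℤ) → ℤ → ℤ
shiftSum []       f x = + 0
shiftSum (a ∷ as) f x = a * f x + shiftSum as f (x + + 1)

shiftSum-vanishes : ∀ L {f} → (∀ y → f y ≡ + 0) → ∀ x → shiftSum L f x ≡ + 0
shiftSum-vanishes []      z x = refl
shiftSum-vanishes (a ∷ L) z x =
  trans (cong₂ (λ u v → a * u + v) (z x) (shiftSum-vanishes L z (x + + 1))) (cong (_+ + 0) (*-zeroʳ a))

shiftSum-++ : ∀ L M f x → shiftSum (L ++ M) f x ≡ shiftSum L f x + shiftSum M f (x + + length L)
shiftSum-++ []      M f x = sym (trans (+-identityˡ _) (cong (shiftSum M f) (+-identityʳ x)))
shiftSum-++ (a ∷ L) M f x = begin
  a * f x + shiftSum (L ++ M) f (x + + 1)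
    ≡⟨ cong (_+_ (a * f x)) (shiftSum-++ L M f (x + + 1)) ⟩
  a * f x + (shiftSum L f (x + + 1) + shiftSum M f (x + + 1 + + length L))
    ≡⟨ sym (+-assoc (a * f x) _ _) ⟩
  a * f x + shiftSum L f (x + + 1) + shiftSum M f (x + + 1 + + length L)
    ≡⟨ cong (λ y → a * f x + shiftSum L f (x + + 1) + shiftSum M f y) (+-assoc x (+ 1) (+ length L)) ⟩
  a * f x + shiftSum L f (x + + 1) + shiftSum M f (x + + length (a ∷ L)) ∎

shiftSum-neg : ∀ L f x → shiftSum (map ℤ.-_ L) f x ≡ - shiftSum L f x
shiftSum-neg []      f x = refl
shiftSum-neg (a ∷ L) f x =
  trans (cong (_+_ (- a * f x)) (shiftSum-neg L f (x + + 1))) (neg-distrib a (f x) _)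
  where
  neg-distrib : ∀ a u v → - a * u + - v ≡ - (a * u + v)
  neg-distrib = solve-∀

shiftSum-Δ : ∀ L m f x → shiftSum L (Δ m f) x ≡ shiftSum L f (x + m) - shiftSum L f x
shiftSum-Δ []      m f x = refl
shiftSum-Δ (a ∷ L) m f x = begin
  a * Δ m f x + shiftSum L (Δ m f) (x + + 1)
    ≡⟨ cong (_+_ (a * Δ m f x)) (shiftSum-Δ L m f (x + + 1)) ⟩
  a * Δ m f x + (shiftSum L f (x + + 1 + m) - shiftSum L f (x + + 1))
    ≡⟨ cong (λ y → a * Δ m f x + (shiftSum L f y - shiftSum L f (x + + 1))) (xy∙z≈xz∙y x (+ 1) m) ⟩
  a * Δ m f x + (shiftSum L f (x + m + + 1) - shiftSum L f (x + + 1))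
    ≡⟨ regroup a (f (x + m)) (f x) _ _ ⟩
  (a * f (x + m) + shiftSum L f (x + m + + 1)) - (a * f x + shiftSum L f (x + + 1)) ∎
  where
  regroup : ∀ a u v A B → a * (u - v) + (A - B) ≡ (a * u + A) - (a * v + B)
  regroup = solve-∀

Annihilates : ℕ → List ℤ → Set
Annihilates n L = ∀ f → DegreeBelow n f → ∀ x → shiftSum L f x ≡ + 0

annihilates-zero : ∀ L → Annihilates zero L
annihilates-zero L f (vanishes z) = shiftSum-vanishes L z

annihilates-difference : ∀ {n} L L′ m → (∀ f x → shiftSum L′ f x ≡ shiftSum L f x - shiftSum L f (x + m)) →
                         Annihilates n L → Annihilates (suc n) L′
annihilates-difference L L′ m L′≡ annihilates f (differences d) x = begin
  shiftSum L′ f x                           ≡⟨ L′≡ f x ⟩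
  shiftSum L f x - shiftSum L f (x + m)     ≡⟨ swap-sub (shiftSum L f x) _ ⟩
  - (shiftSum L f (x + m) - shiftSum L f x) ≡⟨ cong -_ (shiftSum-Δ L m f x) ⟨
  - shiftSum L (Δ m f) x                    ≡⟨ cong -_ (annihilates (Δ m f) (d m) x) ⟩
  - + 0                                     ∎
  where
  swap-sub : ∀ a b → a - b ≡ - (b - a)
  swap-sub = solve-∀

Symmetric Antisymmetric : List ℤ → Set
Symmetric     L = reverse L ≡ L
Antisymmetric L = reverse L ≡ map ℤ.-_ L

last-∷ʳ : ∀ (xs : List ℤ) a → last (xs ∷ʳ a) ≡ just a
last-∷ʳ []           a = refl
last-∷ʳ (x ∷ [])     a = refl
last-∷ʳ (x ∷ y ∷ ys) a = last-∷ʳ (y ∷ ys) a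

last-reverse : ∀ (L : List ℤ) → last L ≡ head (reverse L)
last-reverse L with reverseView L
... | []           = refl
... | xs ∶ _ ∶ʳ x = trans (last-∷ʳ xs x) (cong head (sym (reverse-++ xs (x ∷ []))))

init-∷ʳ-last : ∀ {L a} → last L ≡ just a → L ≡ init L ∷ʳ a
init-∷ʳ-last {x ∷ []}     refl = refl
init-∷ʳ-last {x ∷ y ∷ ys} e    = cong (x ∷_) (init-∷ʳ-last {y ∷ ys} e)

map-neg-involutive : ∀ L → map ℤ.-_ (map ℤ.-_ L) ≡ L
map-neg-involutive L = trans (sym (map-∘ L)) (trans (map-cong neg-involutive L) (map-id L))

mirror-symmetric : ∀ L → Symmetric (mirror L)
mirror-symmetric L = trans (reverse-++ L (reverse L)) (cong (_++ reverse L) (reverse-involutive L))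

antimirror-antisymmetric : ∀ L → Antisymmetric (antimirror L)
antimirror-antisymmetric L = begin
  reverse (c ++ + 0 ∷ m)             ≡⟨ reverse-++ c (+ 0 ∷ m) ⟩
  reverse (+ 0 ∷ m) ++ reverse c     ≡⟨ cong (_++ reverse c) (unfold-reverse (+ 0) m) ⟩
  (reverse m ∷ʳ + 0) ++ reverse c    ≡⟨ ++-assoc (reverse m) (+ 0 ∷ []) (reverse c) ⟩
  reverse m ++ + 0 ∷ reverse c       ≡⟨ cong (_++ + 0 ∷ reverse c) reverse-m ⟩
  map ℤ.-_ c ++ + 0 ∷ reverse c      ≡⟨ cong (λ r → map ℤ.-_ c ++ + 0 ∷ r) (map-neg-involutive (reverse c)) ⟨
  map ℤ.-_ c ++ map ℤ.-_ (+ 0 ∷ m)   ≡⟨ map-++ ℤ.-_ c (+ 0 ∷ m) ⟨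
  map ℤ.-_ (c ++ + 0 ∷ m)            ∎
  where
  c = init L
  m = map ℤ.-_ (reverse c)
  reverse-m : reverse m ≡ map ℤ.-_ c
  reverse-m = trans (sym (reverse-map ℤ.-_ (reverse c))) (cong (map (ℤ.-_)) (reverse-involutive c))

shiftSum-mirror : ∀ {L} → Antisymmetric L → ∀ f x →
                  shiftSum (mirror L) f x ≡ shiftSum L f x - shiftSum L f (x + + length L)
shiftSum-mirror {L} anti f x = begin
  shiftSum (L ++ reverse L) f x                 ≡⟨ shiftSum-++ L (reverse L) f x ⟩
  shiftSum L f x + shiftSum (reverse L) f x′    ≡⟨ cong (λ M → shiftSum L f x + shiftSum M f x′) anti ⟩
  shiftSum L f x + shiftSum (map ℤ.-_ L) f x′   ≡⟨ cong (_+_ (shiftSum L f x)) (shiftSum-neg L f x′) ⟩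
  shiftSum L f x - shiftSum L f x′              ∎
  where x′ = x + + length L

shiftSum-antimirror : ∀ {L a} → last L ≡ just a → Symmetric L → ∀ f x →
                      shiftSum (antimirror L) f x ≡ shiftSum L f x - shiftSum L f (x + + length (init L))
shiftSum-antimirror {L} {a} last≡a sym-L f x = begin
  shiftSum (c ++ + 0 ∷ map ℤ.-_ rc) f x
    ≡⟨ shiftSum-++ c (+ 0 ∷ map ℤ.-_ rc) f x ⟩
  shiftSum c f x + (+ 0 * f x′ + shiftSum (map ℤ.-_ rc) f (x′ + + 1))
    ≡⟨ cong (λ v → shiftSum c f x + (+ 0 * f x′ + v)) (shiftSum-neg rc f (x′ + + 1)) ⟩
  shiftSum c f x + (+ 0 * f x′ + - shiftSum rc f (x′ + + 1))
    ≡⟨ regroup (shiftSum c f x) a (f x′) _ ⟩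
  (shiftSum c f x + (a * f x′ + + 0)) - shiftSum (a ∷ rc) f x′
    ≡⟨ cong (_- shiftSum (a ∷ rc) f x′) (shiftSum-++ c (a ∷ []) f x) ⟨
  shiftSum (c ∷ʳ a) f x - shiftSum (a ∷ rc) f x′
    ≡⟨ cong₂ (λ M N → shiftSum M f x - shiftSum N f x′) (sym L≡) a∷rc≡L ⟩
  shiftSum L f x - shiftSum L f x′ ∎
  where
  c  = init L
  rc = reverse c
  x′ = x + + length c
  L≡ : L ≡ c ∷ʳ a
  L≡ = init-∷ʳ-last last≡a
  a∷rc≡L : a ∷ rc ≡ L
  a∷rc≡L = trans (sym (reverse-++ c (a ∷ []))) (trans (cong reverse (sym L≡)) sym-L)
  regroup : ∀ C a u R → C + (+ 0 * u + - R) ≡ (C + (a * u + + 0)) - (a * u + R)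
  regroup = solve-∀

step-mirror : ∀ {L a b} → head L ≡ just a → last L ≡ just b → a ≡ - b → step L ≡ mirror L
step-mirror {L} head≡ last≡ a≡-b with head L | last L
step-mirror {a = a} {b} refl refl a≡-b | just .a | just .b with a ≟ - b
... | yes _    = refl
... | no  a≢-b = contradiction a≡-b a≢-b

step-antimirror : ∀ {L a b} → head L ≡ just a → last L ≡ just b → ¬ a ≡ - b → a ≡ b → step L ≡ antimirror L
step-antimirror {L} head≡ last≡ a≢-b a≡b with head L | last L
step-antimirror {a = a} {b} refl refl a≢-b a≡b | just .a | just .b with a ≟ - b
... | yes a≡-b = contradiction a≡-b a≢-b
... | no  _ with a ≟ b
...   | yes _   = refl
...   | no  a≢b = contradiction a≡b a≢b

-- Two entries at least, so that init keeps the leading 1.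
data StartsWithOne : List ℤ → Set where
  startsWithOne : ∀ y t → StartsWithOne (+ 1 ∷ y ∷ t)

startsWithOne-++ : ∀ c z zs → StartsWithOne (+ 1 ∷ c ++ z ∷ zs)
startsWithOne-++ []      z zs = startsWithOne z zs
startsWithOne-++ (y ∷ c) z zs = startsWithOne y (c ++ z ∷ zs)

record PInvariant (n : ℕ) (L : List ℤ) : Set where
  field
    starts      : StartsWithOne L
    parity      : Symmetric L ⊎ Antisymmetric L
    annihilates : Annihilates n L

pInvariant-step : ∀ {n L} → PInvariant n L → PInvariant (suc n) (step L)
pInvariant-step {n} record { starts = startsWithOne y t ; parity = inj₂ anti ; annihilates = ann } =
  subst (PInvariant (suc n)) (sym (step-mirror {L} refl last≡-1 refl)) record
    { starts      = startsWithOne y (t ++ reverse L)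
    ; parity      = inj₁ (mirror-symmetric L)
    ; annihilates = annihilates-difference L (mirror L) (+ length L)
                      (shiftSum-mirror {L} anti) ann
    }
  where
  L = + 1 ∷ y ∷ t
  last≡-1 : last L ≡ just (- + 1)
  last≡-1 = trans (last-reverse L) (cong head anti)
pInvariant-step {n} record { starts = startsWithOne y t ; parity = inj₁ sym-L ; annihilates = ann } =
  subst (PInvariant (suc n)) (sym (step-antimirror {L} refl last≡1 (λ ()) refl)) record
    { starts      = startsWithOne-++ (init (y ∷ t)) (+ 0) _
    ; parity      = inj₂ (antimirror-antisymmetric L)
    ; annihilates = annihilates-difference L (antimirror L) (+ length (init L))
                      (shiftSum-antimirror {L} last≡1 sym-L) ann
    }
  where
  L = + 1 ∷ y ∷ t
  last≡1 : last L ≡ just (+ 1)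
  last≡1 = trans (last-reverse L) (cong head sym-L)

pInvariant : ∀ m → PInvariant (suc m) (P (suc m))
pInvariant zero = record
  { starts      = startsWithOne _ []
  ; parity      = inj₂ refl
  ; annihilates = annihilates-difference (+ 1 ∷ []) (P 1) (+ 1) difference
                    (annihilates-zero (+ 1 ∷ []))
  }
  where
  regroup : ∀ u v → + 1 * u + (- + 1 * v + + 0) ≡ (+ 1 * u + + 0) - (+ 1 * v + + 0)
  regroup = solve-∀
  difference : ∀ f x → shiftSum (P 1) f x ≡ shiftSum (+ 1 ∷ []) f x - shiftSum (+ 1 ∷ []) f (x + + 1)
  difference f x = regroup (f x) (f (x + + 1))
pInvariant (suc m) = pInvariant-step (pInvariant m)

Fsum≡shiftSum : ∀ j L s x → Fsum j L s x ≡ shiftSum L (_^ s) (+ j + x)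
Fsum≡shiftSum j []      s x = refl
Fsum≡shiftSum j (a ∷ L) s x =
  cong (_+_ (a * (+ j + x) ^ s))
       (trans (Fsum≡shiftSum (suc j) L s x) (cong (shiftSum L (_^ s)) (next-index (+ j) x)))
  where
  next-index : ∀ i x → (+ 1 + i) + x ≡ (i + x) + + 1
  next-index = solve-∀

lemma1 : (n : ℕ) → 1 ≤ n → (s : ℕ) → s < n → (x : ℤ) → F n s x ≡ + 0
lemma1 (suc m) _ s s<n x =
  trans (Fsum≡shiftSum 0 (P (suc m)) s x)
        (PInvariant.annihilates (pInvariant m) (_^ s) (degreeBelow-mono s<n (degreeBelow-^ s)) (+ 0 + x))
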